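{- Consider odd positive integers $m$ such that the quadruple $(m,S(m),S^2(m),S^3(m))$ has distinct coordinates and $S(m)<m<S^2(m)$ (i.e. the triple $(m,S(m),S^2(m))$ has permutation pattern $(2,1,3)$). For such quadruples the only possible permutation patterns are $(2,1,3,4)$, $(2,1,4,3)$, $(3,1,4,2)$, $(3,2,4,1)$, and their permutation densities are \[ d_4(2,1,3,4)=\tfrac1{16},\quad d_4(3,1,4,2)=\tfrac1{32},\quad d_4(3,2,4,1)=\tfrac1{32},\quad d_4(2,1,4,3)=0. \] Moreover, the permutation pattern $(2,1,4,3)$ never occurs for any quadruple $(m,S(m),S^2(m),S^3(m))$.
   Context: Let $\Omega$ be the set of odd positive integers. The Syracuse function $S:\Omega\to\Omega$ is defined by $S(m)=(3m+1)/2^e$, where $e$ is the largest integer with $2^e\mid 3m+1$. Let $\Sigma_n$ be the permutations of $\{1,\dots,n\}$. For an $n$-tuple $X=(x_1,\dots,x_n)$ of distinct reals with coordinates in increasing order $y_1<\dots<y_n$, the permutation pattern of $X$ is the unique $\sigma\in\Sigma_n$ with $x_i=y_{\sigma(i)}$, written $(\sigma(1),\dots,\sigma(n))$. For $\sigma\in\Sigma_n$, $\Gamma_\sigma(M)$ is the number of $m\in\Omega$, $m\le M$, such that $(m,S(m),\dots,S^{n-1}(m))$ has distinct coordinates and permutation pattern $\sigma$, and $d_n(\sigma)=\lim_{M\to\infty}\Gamma_\sigma(M)/(M/2)$. -}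

module Defs where

open import Data.Nat using (ℕ; zero; suc; _+_; _*_; _^_; _≤_; _<_; _≟_; _<?_; _≤?_; NonZero)
open import Data.Nat.Properties using (m^n≢0)
open import Data.Nat.DivMod using (_/_; _%_)
open import Data.Bool using (Bool; true; false; if_then_else_)
open import Data.List using (List; []; _∷_; map; length; filter; upTo)
import Data.List.Relation.Unary.Unique.DecPropositional as UniqueDec
open import Data.Product using (_×_)
open import Relation.Binary.PropositionalEquality using (_≡_)
open import Relation.Nullary using (Dec; yes; no; ¬_)
open import Relation.Nullary.Decidable using (_×-dec_; ⌊_⌋)
import Data.List.Properties as LP
open import Data.Integer using (+_)
open import Data.Rational as ℚ using (ℚ; 0ℚ)

-- Odd naturals (the set Ω is the odd positive integers; odd implies positive).
Odd : ℕ → Set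
Odd m = m % 2 ≡ 1

odd? : (m : ℕ) → Dec (Odd m)
odd? m = (m % 2) ≟ 1

-- 2-adic valuation of n > 0 : the largest e with 2^e ∣ n.
-- Computed by repeatedly halving; the fuel n suffices since e ≤ n.
v2-fuel : ℕ → ℕ → ℕ
v2-fuel zero     n = 0
v2-fuel (suc f) zero = 0
v2-fuel (suc f) (suc k) with (suc k) % 2 ≟ 0
... | yes _ = suc (v2-fuel f (suc k / 2))
... | no  _ = 0

v2 : ℕ → ℕ
v2 n = v2-fuel n n

syracuse : ℕ → ℕ
syracuse m = (3 * m + 1) / (2 ^ v2 (3 * m + 1))
  where
  instance
    nz : NonZero (2 ^ v2 (3 * m + 1))
    nz = m^n≢0 2 (v2 (3 * m + 1))

iter : ℕ → (ℕ → ℕ) → ℕ → ℕ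
iter zero    f x = x
iter (suc k) f x = f (iter k f x)

orbit : ℕ → ℕ → List ℕ
orbit n m = map (λ i → iter i syracuse m) (upTo n)

-- rank of x among the coordinates of xs (1-based): 1 + #{ j : x_j < x }.
-- For distinct coordinates y_1<...<y_n, x_i = y_{rank x_i}.
rank : List ℕ → ℕ → ℕ
rank xs x = suc (length (filter (λ y → y <? x) xs))

pattern′ : List ℕ → List ℕ
pattern′ xs = map (rank xs) xs

open UniqueDec _≟_ using (Unique; unique?)

HasPattern : List ℕ → ℕ → Set
HasPattern σ m = Unique (orbit (length σ) m) × pattern′ (orbit (length σ) m) ≡ σ

hasPattern? : (σ : List ℕ) (m : ℕ) → Dec (HasPattern σ m)
hasPattern? σ m = unique? (orbit (length σ) m) ×-dec LP.≡-dec _≟_ (pattern′ (orbit (length σ) m)) σ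

Γ : List ℕ → ℕ → ℕ
Γ σ M = length (filter (λ m → odd? m ×-dec hasPattern? σ m) (upTo (suc M)))

-- d_n(σ) = d, i.e. lim_{M→∞} Γ_σ(M) / (M/2) = d  (M ranges over positive integers, M = suc k)
HasDensity : List ℕ → ℚ → Set
HasDensity σ d =
  (ε : ℚ) → 0ℚ ℚ.< ε →
  Data.Product.∃ λ N → (k : ℕ) → N ≤ k →
    ℚ.∣ (+ (2 * Γ σ (suc k))) ℚ./ (suc k) ℚ.- d ∣ ℚ.< ε

-- Write 3m + 1 = 2^e · S(m) with S(m) odd. On an arithmetic progression r + tK whose
-- modulus carries enough factors of 2 the exponent e is constant, so S acts there as an
-- affine map t ↦ q + tL. Splitting the odd numbers along the 2-adic tree, the condition
-- S(m) < m < S²(m) fails on 3 (mod 4), 5 (mod 8) and 1 (mod 16) and leaves exactly the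
-- classes 9 (mod 32), 57 (mod 64) and 25 (mod 64). On each of them the first iterates are
-- affine in t (for 25 (mod 64) an upper bound on S³ suffices), and comparing these affine
-- functions gives the patterns (2,1,3,4), (3,1,4,2) and (3,2,4,1) respectively, so (2,1,4,3)
-- never occurs. Each pattern is thus carried by one residue class modulo 2D, and such a
-- class contains 1/D of the odd numbers in the limit.

module Submission where

open import Defs
open import Data.Nat using (ℕ; _<_)
open import Data.List using (List; []; _∷_)
open import Data.Product using (_×_)
open import Data.Sum using (_⊎_)
open import Data.Integer using (+_)
open import Data.Rational using (_/_; 0ℚ)
open import Relation.Nullary using (¬_)
open import Data.List.Relation.Unary.Unique.Propositional using (Unique)

open import Level using (0ℓ)
open import Data.Nat hiding (_/_; parity)
open import Data.Nat.Properties
open import Data.Nat.DivMod using (_%_; %-distribˡ-+; %-distribˡ-*; m≡m%n+[m/n]*n; [m+kn]%n≡m%n; [m+n]%n≡m%n; m*n/n≡m; m%n<n; m<n⇒m%n≡m)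
  renaming (_/_ to _div_)
open import Data.Nat.Tactic.RingSolver using (solve-∀)
open import Data.Integer as ℤ using (+[1+_]; -[1+_]; _⊖_)
import Data.Integer.Properties as ℤ
open import Data.Rational as ℚ using (ℚ; mkℚ)
import Data.Rational.Properties as ℚ
open import Data.Rational.Unnormalised as ℚᵘ using (mkℚᵘ; *<*)
import Data.Rational.Unnormalised.Properties as ℚᵘ
open import Data.Bool using (T)
open import Data.List using (length; filter; upTo; _++_; _∷ʳ_)
open import Data.List.Properties using (filter-accept; filter-reject; filter-++; filter-≐; filter-none; length-++; upTo-∷ʳ)
open import Data.List.Relation.Unary.All using (universal)
open import Data.List.Relation.Unary.Unique.DecPropositional _≟_ using (unique?)
import Data.List.Relation.Unary.Unique.Propositional.Properties as Unique
open import Data.Product using (∃; ∃-syntax; _,_; proj₁; proj₂)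
open import Data.Sum using (inj₁; inj₂; [_,_]′)
open import Function using (_∘′_; case_of_)
open import Relation.Nullary using (yes; no; contradiction)
open import Relation.Nullary.Decidable using (True; toWitness; _×-dec_)
open import Relation.Unary using (Pred; Decidable; _≐_)
open import Relation.Unary.Properties using (≐-trans)
open import Algebra.Properties.CommutativeSemigroup +-commutativeSemigroup using (xy∙z≈xz∙y)
open import Relation.Binary.PropositionalEquality

infix 4 _≡_⟨mod_⟩

_≡_⟨mod_⟩ : ℕ → ℕ → ℕ → Set
m ≡ r ⟨mod K ⟩ = ∃[ t ] m ≡ r + t * K

⟨mod⟩≐% : ∀ r K .{{_ : NonZero K}} {_ : T (r <ᵇ K)} → (λ m → m ≡ r ⟨mod K ⟩) ≐ (λ m → m % K ≡ r)
⟨mod⟩≐% r K {r<K} = (λ { (t , refl) → trans ([m+kn]%n≡m%n r t K) (m<n⇒m%n≡m (<ᵇ⇒< r K r<K)) })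
                  , λ {m} m%K≡r → m div K , trans (m≡m%n+[m/n]*n m K) (cong (_+ m div K * K) m%K≡r)

even⊎odd : ∀ n → n ≡ 0 ⟨mod 2 ⟩ ⊎ n ≡ 1 ⟨mod 2 ⟩
even⊎odd zero = inj₁ (0 , refl)
even⊎odd (suc n) with even⊎odd n
... | inj₁ (a , n≡2a)   = inj₂ (a , cong suc n≡2a)
... | inj₂ (a , n≡1+2a) = inj₁ (suc a , cong suc n≡1+2a)

refine : ∀ {m r K} → m ≡ r ⟨mod K ⟩ → m ≡ r ⟨mod 2 * K ⟩ ⊎ m ≡ r + K ⟨mod 2 * K ⟩
refine {r = r} {K} (t , refl) with even⊎odd t
... | inj₁ (a , refl) = inj₁ (a , even-step r K a)
  where
  even-step : ∀ r K a → r + (0 + a * 2) * K ≡ r + a * (2 * K)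
  even-step = solve-∀
... | inj₂ (a , refl) = inj₂ (a , odd-step r K a)
  where
  odd-step : ∀ r K a → r + (1 + a * 2) * K ≡ r + K + a * (2 * K)
  odd-step = solve-∀

odd⇒1mod2 : ∀ {m} → Odd m → m ≡ 1 ⟨mod 2 ⟩
odd⇒1mod2 {m} odd = m div 2 , trans (m≡m%n+[m/n]*n m 2) (cong (_+ m div 2 * 2) odd)

odd+even : ∀ {a b} → Odd a → b % 2 ≡ 0 → Odd (a + b)
odd+even {a} {b} odd even = trans (%-distribˡ-+ a b 2) (cong₂ (λ x y → (x + y) % 2) odd even)

even-*ʳ : ∀ t {b} → b % 2 ≡ 0 → (t * b) % 2 ≡ 0
even-*ʳ t {b} even = begin
  (t * b) % 2             ≡⟨ %-distribˡ-* t b 2 ⟩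
  (t % 2 * (b % 2)) % 2   ≡⟨ cong (λ y → (t % 2 * y) % 2) even ⟩
  (t % 2 * 0) % 2         ≡⟨ cong (_% 2) (*-zeroʳ (t % 2)) ⟩
  0                       ∎
  where open ≡-Reasoning

odd-progression : ∀ {m} r K → Odd r → K % 2 ≡ 0 → m ≡ r ⟨mod K ⟩ → Odd m
odd-progression r K odd even (t , refl) = odd+even {r} {t * K} odd (even-*ʳ t even)

even⇒¬odd : ∀ {m} → m ≡ 0 ⟨mod 2 ⟩ → ¬ Odd m
even⇒¬odd (a , refl) odd with () ← trans (sym ([m+kn]%n≡m%n 0 a 2)) odd

odd⇐¬even : ∀ n → n % 2 ≢ 0 → Odd n
odd⇐¬even n n≢0 with n % 2 | m%n<n n 2
... | 0           | _ = contradiction refl n≢0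
... | 1           | _ = refl
... | suc (suc _) | s≤s (s≤s ())

-- The side conditions on the numerals are closed booleans, discharged by evaluation.
affine-< : ∀ a b c d t → {T (a <ᵇ c)} → {T (b ≤ᵇ d)} → a + t * b < c + t * d
affine-< a b c d t {a<c} {b≤d} = +-mono-<-≤ (<ᵇ⇒< a c a<c) (*-monoʳ-≤ t (≤ᵇ⇒≤ b d b≤d))

affine-≤ : ∀ a b c d t → {T (a ≤ᵇ c)} → {T (b ≤ᵇ d)} → a + t * b ≤ c + t * d
affine-≤ a b c d t {a≤c} {b≤d} = +-mono-≤ (≤ᵇ⇒≤ a c a≤c) (*-monoʳ-≤ t (≤ᵇ⇒≤ b d b≤d))

-- Counting the points of a periodic set

module Counting {P : Pred ℕ 0ℓ} (P? : Decidable P) where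

  count : ℕ → ℕ
  count n = length (filter P? (upTo n))

  hit : ℕ → ℕ
  hit n = length (filter P? (n ∷ []))

  count-suc : ∀ n → count (suc n) ≡ count n + hit n
  count-suc n = begin
    length (filter P? (upTo (suc n)))                 ≡⟨ cong (length ∘′ filter P?) (sym (upTo-∷ʳ n)) ⟩
    length (filter P? (upTo n ∷ʳ n))                  ≡⟨ cong length (filter-++ P? (upTo n) (n ∷ [])) ⟩
    length (filter P? (upTo n) ++ filter P? (n ∷ [])) ≡⟨ length-++ (filter P? (upTo n)) ⟩
    count n + hit n                                   ∎
    where open ≡-Reasoning

  count-mono : ∀ {m n} → m ≤ n → count m ≤ count n
  count-mono m≤n = go (≤⇒≤′ m≤n)
    where
    go : ∀ {m n} → m ≤′ n → count m ≤ count n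
    go ≤′-refl            = ≤-refl
    go (≤′-step {n} m≤′n) = ≤-trans (go m≤′n) (subst (count n ≤_) (sym (count-suc n)) (m≤m+n (count n) (hit n)))

  hit-cong : ∀ {x y} → (P x → P y) → (P y → P x) → hit x ≡ hit y
  hit-cong {x} {y} x⇒y y⇒x with P? x | P? y
  ... | yes _  | yes _  = refl
  ... | yes px | no ¬py = contradiction (x⇒y px) ¬py
  ... | no ¬px | yes py = contradiction (y⇒x py) ¬px
  ... | no _   | no _   = refl

  module _ (K : ℕ) (periodic : P ≐ (λ n → P (n + K))) where

    count-+-period : ∀ n → count (n + K) ≡ count n + count K
    count-+-period zero    = refl
    count-+-period (suc n) = begin
      count (suc (n + K))          ≡⟨ count-suc (n + K) ⟩
      count (n + K) + hit (n + K)  ≡⟨ cong₂ _+_ (count-+-period n) (hit-cong (proj₂ periodic) (proj₁ periodic)) ⟩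
      count n + count K + hit n    ≡⟨ xy∙z≈xz∙y (count n) (count K) (hit n) ⟩
      count n + hit n + count K    ≡⟨ cong (_+ count K) (sym (count-suc n)) ⟩
      count (suc n) + count K      ∎
      where open ≡-Reasoning

    count-*-period : ∀ q → count (q * K) ≡ q * count K
    count-*-period zero    = refl
    count-*-period (suc q) = begin
      count (K + q * K)          ≡⟨ cong count (+-comm K (q * K)) ⟩
      count (q * K + K)          ≡⟨ count-+-period (q * K) ⟩
      count (q * K) + count K    ≡⟨ cong (_+ count K) (count-*-period q) ⟩
      q * count K + count K      ≡⟨ +-comm (q * count K) (count K) ⟩
      suc q * count K            ∎
      where open ≡-Reasoning

    count-bounds : .{{_ : NonZero K}} → count K ≡ 1 → ∀ N → count N * K ≤ N + K × N ≤ count N * K + K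
    count-bounds one-per-period N = upper , lower
      where
      q = N div K
      N≡ : N ≡ N % K + q * K
      N≡ = m≡m%n+[m/n]*n N K
      count-qK : ∀ q → count (q * K) ≡ q
      count-qK q = trans (count-*-period q) (trans (cong (q *_) one-per-period) (*-identityʳ q))
      qK≤N : q * K ≤ N
      qK≤N = subst (q * K ≤_) (sym N≡) (m≤n+m (q * K) (N % K))
      N≤K+qK : N ≤ K + q * K
      N≤K+qK = subst (_≤ K + q * K) (sym N≡) (+-monoˡ-≤ (q * K) (<⇒≤ (m%n<n N K)))
      q≤count : q ≤ count N
      q≤count = subst (_≤ count N) (count-qK q) (count-mono qK≤N)
      count≤1+q : count N ≤ suc q
      count≤1+q = subst (count N ≤_) (count-qK (suc q)) (count-mono N≤K+qK)
      upper : count N * K ≤ N + K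
      upper = begin
        count N * K   ≤⟨ *-monoˡ-≤ K count≤1+q ⟩
        K + q * K     ≤⟨ +-monoʳ-≤ K qK≤N ⟩
        K + N         ≡⟨ +-comm K N ⟩
        N + K         ∎
        where open ≤-Reasoning
      lower : N ≤ count N * K + K
      lower = begin
        N             ≤⟨ N≤K+qK ⟩
        K + q * K     ≤⟨ +-monoʳ-≤ K (*-monoˡ-≤ K q≤count) ⟩
        K + count N * K ≡⟨ +-comm K (count N * K) ⟩
        count N * K + K ∎
        where open ≤-Reasoning

-- HasDensity σ d unfolds to RatiosTendTo (λ k → 2 * Γ σ (suc k)) d.
RatiosTendTo : (ℕ → ℕ) → ℚ → Set
RatiosTendTo a d = (ε : ℚ) → 0ℚ ℚ.< ε → ∃ λ N → (k : ℕ) → N ≤ k → ℚ.∣ (+ a k) ℚ./ suc k ℚ.- d ∣ ℚ.< ε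

∣⊖∣≤ : ∀ {a b c} → a ≤ b + c → b ≤ a + c → ℤ.∣ a ⊖ b ∣ ≤ c
∣⊖∣≤ {a} {b} a≤b+c b≤a+c with ≤-total a b
... | inj₁ a≤b = subst (_≤ _) (sym (ℤ.∣⊖∣-≤ a≤b)) (m≤n+o⇒m∸n≤o b a b≤a+c)
... | inj₂ b≤a = subst (_≤ _) (sym (trans (ℤ.∣m⊖n∣≡∣n⊖m∣ a b) (ℤ.∣⊖∣-≤ b≤a))) (m≤n+o⇒m∸n≤o a b a≤b+c)

-- In ℚᵘ the difference x/(k+1) − 1/D has numerator x·D − (k+1) and denominator (k+1)·D on the nose.
distance-<ᵘ : ∀ x k D′ p e → ℤ.∣ x * suc D′ ⊖ suc k ∣ * suc e < suc p * (suc k * suc D′) →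
              ℚᵘ.∣ mkℚᵘ (+ x) k ℚᵘ.- mkℚᵘ (+ 1) D′ ∣ ℚᵘ.< mkℚᵘ +[1+ p ] e
distance-<ᵘ x k D′ p e h =
  *<* (subst₂ ℤ._<_ (ℤ.pos-* (ℤ.∣ numerator ∣) (suc e)) (ℤ.pos-* (suc p) (suc k * suc D′))
                    (ℤ.+<+ (subst (λ z → ℤ.∣ z ∣ * suc e < _) (sym numerator≡) h)))
  where
  numerator = (+ x) ℤ.* (+ suc D′) ℤ.+ -[1+ 0 ] ℤ.* (+ suc k)
  numerator≡ : numerator ≡ x * suc D′ ⊖ suc k
  numerator≡ = trans (cong₂ ℤ._+_ (sym (ℤ.pos-* x (suc D′))) (ℤ.-1*i≡-i (+ suc k))) (ℤ.m-n≡m⊖n (x * suc D′) (suc k))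

toℚᵘ-distance : ∀ x k D′ → ℚ.toℚᵘ (ℚ.∣ (+ x) ℚ./ suc k ℚ.- (+ 1) ℚ./ suc D′ ∣) ℚᵘ.≃ ℚᵘ.∣ mkℚᵘ (+ x) k ℚᵘ.- mkℚᵘ (+ 1) D′ ∣
toℚᵘ-distance x k D′ = ℚᵘ.≃-trans (ℚ.toℚᵘ-homo-∣-∣ (p ℚ.- q))
  (ℚᵘ.∣-∣-cong (ℚᵘ.≃-trans (ℚ.toℚᵘ-homo-+ p (ℚ.- q))
    (ℚᵘ.+-cong (ℚ.toℚᵘ-fromℚᵘ (mkℚᵘ (+ x) k))
               (ℚᵘ.≃-trans (ℚ.toℚᵘ-homo‿- q) (ℚᵘ.-‿cong (ℚ.toℚᵘ-fromℚᵘ (mkℚᵘ (+ 1) D′)))))))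
  where
  p = (+ x) ℚ./ suc k
  q = (+ 1) ℚ./ suc D′

ratiosTendTo-1/D : ∀ a D′ B → (∀ k → a k * suc D′ ≤ suc k + B) → (∀ k → suc k ≤ a k * suc D′ + B) →
                   RatiosTendTo a ((+ 1) ℚ./ suc D′)
ratiosTendTo-1/D a D′ B upper lower (mkℚ +[1+ p ] e _) _ = B * suc e , λ k B[1+e]≤k →
  ℚ.toℚᵘ-cancel-< (ℚᵘ.<-respˡ-≃ (ℚᵘ.≃-sym (toℚᵘ-distance (a k) k D′)) (distance-<ᵘ (a k) k D′ p e (bound k B[1+e]≤k)))
  where
  D = suc D′
  bound : ∀ k → B * suc e ≤ k → ℤ.∣ a k * D ⊖ suc k ∣ * suc e < suc p * (suc k * D)
  bound k B[1+e]≤k = begin-strict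
    ℤ.∣ a k * D ⊖ suc k ∣ * suc e  ≤⟨ *-monoˡ-≤ (suc e) (∣⊖∣≤ (upper k) (lower k)) ⟩
    B * suc e                     ≤⟨ B[1+e]≤k ⟩
    k                             <⟨ n<1+n k ⟩
    suc k                         ≤⟨ m≤m*n (suc k) D ⟩
    suc k * D                     ≤⟨ m≤n*m (suc k * D) (suc p) ⟩
    suc p * (suc k * D)           ∎
    where open ≤-Reasoning
ratiosTendTo-1/D a D′ B upper lower (mkℚ (+ 0)     _ _) (ℚ.*<* (ℤ.+<+ ()))
ratiosTendTo-1/D a D′ B upper lower (mkℚ -[1+ _ ] _ _) (ℚ.*<* ())

ratiosTendTo-0 : ∀ a → (∀ k → a k ≡ 0) → RatiosTendTo a 0ℚ
ratiosTendTo-0 a a≡0 ε 0<ε = 0 , λ k _ →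
  subst (λ q → ℚ.∣ q ℚ.- 0ℚ ∣ ℚ.< ε) (sym (trans (cong (λ n → (+ n) ℚ./ suc k) (a≡0 k)) (ℚ.0/n≡0 (suc k)))) 0<ε

σ2134 σ2143 σ3142 σ3241 : List ℕ
σ2134 = 2 ∷ 1 ∷ 3 ∷ 4 ∷ []
σ2143 = 2 ∷ 1 ∷ 4 ∷ 3 ∷ []
σ3142 = 3 ∷ 1 ∷ 4 ∷ 2 ∷ []
σ3241 = 3 ∷ 2 ∷ 4 ∷ 1 ∷ []

Pattern : List ℕ → List ℕ → Set
Pattern xs σ = Unique xs × pattern′ xs ≡ σ

-- Equal entries have equal ranks, so a list whose pattern is duplicate-free is duplicate-free.
pattern⇒Pattern : ∀ {xs σ} {_ : True (unique? σ)} → pattern′ xs ≡ σ → Pattern xs σ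
pattern⇒Pattern {xs} {_} {σ!} refl = Unique.map⁻ (toWitness σ!) , refl

data Below (y x : ℕ) : ℕ → Set where
  below     : y < x → Below y x 1
  not-below : y ≮ x → Below y x 0

above : ∀ {y x} → x < y → Below y x 0
above x<y = not-below (<-asym x<y)

self : ∀ {x} → Below x x 0
self = not-below (<-irrefl refl)

rank-∷ : ∀ {y x i} ys → Below y x i → rank (y ∷ ys) x ≡ i + rank ys x
rank-∷ {x = x} ys (below y<x)     = cong (suc ∘′ length) (filter-accept (_<? x) y<x)
rank-∷ {x = x} ys (not-below y≮x) = cong (suc ∘′ length) (filter-reject (_<? x) y≮x)

rank4 : ∀ {x a b c d i j k l} → Below a x i → Below b x j → Below c x k → Below d x l →
        rank (a ∷ b ∷ c ∷ d ∷ []) x ≡ i + (j + (k + (l + 1)))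
rank4 {i = i} {j} {k} a? b? c? d? =
  trans (rank-∷ _ a?) (cong (_+_ i)
    (trans (rank-∷ _ b?) (cong (_+_ j)
      (trans (rank-∷ _ c?) (cong (_+_ k) (rank-∷ _ d?))))))

ranks⇒pattern : ∀ {a b c d i j k l} → let xs = a ∷ b ∷ c ∷ d ∷ [] in
                rank xs a ≡ i → rank xs b ≡ j → rank xs c ≡ k → rank xs d ≡ l → pattern′ xs ≡ i ∷ j ∷ k ∷ l ∷ []
ranks⇒pattern refl refl refl refl = refl

pattern-2134 : ∀ {a b c d} → b < a → a < c → c < d → pattern′ (a ∷ b ∷ c ∷ d ∷ []) ≡ σ2134
pattern-2134 {a} {b} {c} {d} b<a a<c c<d = ranks⇒pattern {a} {b} {c} {d}
  (rank4 self        (below b<a) (above a<c) (above a<d))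
  (rank4 (above b<a) self        (above b<c) (above b<d))
  (rank4 (below a<c) (below b<c) self        (above c<d))
  (rank4 (below a<d) (below b<d) (below c<d) self)
  where
  a<d = <-trans a<c c<d
  b<c = <-trans b<a a<c
  b<d = <-trans b<c c<d

pattern-3142 : ∀ {a b c d} → b < d → d < a → a < c → pattern′ (a ∷ b ∷ c ∷ d ∷ []) ≡ σ3142
pattern-3142 {a} {b} {c} {d} b<d d<a a<c = ranks⇒pattern {a} {b} {c} {d}
  (rank4 self        (below b<a) (above a<c) (below d<a))
  (rank4 (above b<a) self        (above b<c) (above b<d))
  (rank4 (below a<c) (below b<c) self        (below d<c))
  (rank4 (above d<a) (below b<d) (above d<c) self)
  where
  b<a = <-trans b<d d<a
  b<c = <-trans b<a a<c
  d<c = <-trans d<a a<c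

pattern-3241 : ∀ {a b c d} → d < b → b < a → a < c → pattern′ (a ∷ b ∷ c ∷ d ∷ []) ≡ σ3241
pattern-3241 {a} {b} {c} {d} d<b b<a a<c = ranks⇒pattern {a} {b} {c} {d}
  (rank4 self        (below b<a) (above a<c) (below d<a))
  (rank4 (above b<a) self        (above b<c) (below d<b))
  (rank4 (below a<c) (below b<c) self        (below d<c))
  (rank4 (above d<a) (above d<b) (above d<c) self)
  where
  b<c = <-trans b<a a<c
  d<a = <-trans d<b b<a
  d<c = <-trans d<a a<c

rank-mono : ∀ xs {x y} → y ≤ x → rank xs y ≤ rank xs x
rank-mono []       _ = ≤-refl
rank-mono (z ∷ zs) {x} {y} y≤x with z <? y | z <? x
... | yes z<y | yes z<x rewrite rank-∷ zs (below z<y)     | rank-∷ zs (below z<x)     = s≤s (rank-mono zs y≤x)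
... | yes z<y | no  z≮x = contradiction (<-≤-trans z<y y≤x) z≮x
... | no  z≮y | yes z<x rewrite rank-∷ zs (not-below z≮y) | rank-∷ zs (below z<x)     = m≤n⇒m≤1+n (rank-mono zs y≤x)
... | no  z≮y | no  z≮x rewrite rank-∷ zs (not-below z≮y) | rank-∷ zs (not-below z≮x) = rank-mono zs y≤x

rank-reflects-< : ∀ xs {x y} → rank xs x < rank xs y → x < y
rank-reflects-< xs {x} {y} r<r with x <? y
... | yes x<y = x<y
... | no  x≮y = contradiction r<r (≤⇒≯ (rank-mono xs (≮⇒≥ x≮y)))

-- The 2-adic valuation and the Syracuse map

v2-fuel-spec : ∀ f n → 0 < n → n ≤ f → ∃[ q ] Odd q × n ≡ 2 ^ v2-fuel f n * q
v2-fuel-spec (suc f) (suc k) _ n≤1+f with suc k % 2 ≟ 0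
... | no  n≢0 = suc k , odd⇐¬even (suc k) n≢0 , sym (*-identityˡ (suc k))
... | yes n≡0 with suc k div 2 | trans (m≡m%n+[m/n]*n (suc k) 2) (cong (_+ suc k div 2 * 2) n≡0)
...   | suc a | n≡[1+a]*2 with v2-fuel-spec f (suc a) (s≤s z≤n) 1+a≤f
  where
  1+a≤f : suc a ≤ f
  1+a≤f = ≤-trans (s≤s (m≤m*n a 2)) (≤-pred (subst (_≤ suc f) n≡[1+a]*2 n≤1+f))
...     | q , odd , 1+a≡2^e*q = q , odd , (begin
  suc k                      ≡⟨ n≡[1+a]*2 ⟩
  suc a * 2                  ≡⟨ *-comm (suc a) 2 ⟩
  2 * suc a                  ≡⟨ cong (2 *_) 1+a≡2^e*q ⟩
  2 * (2 ^ e * q)            ≡⟨ sym (*-assoc 2 (2 ^ e) q) ⟩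
  2 ^ suc e * q              ∎)
  where
  open ≡-Reasoning
  e = v2-fuel f (suc a)

v2-spec : ∀ n → 0 < n → ∃[ q ] Odd q × n ≡ 2 ^ v2 n * q
v2-spec n 0<n = v2-fuel-spec n n 0<n ≤-refl

odd-part-unique : ∀ e e′ {q q′} → Odd q → Odd q′ → 2 ^ e * q ≡ 2 ^ e′ * q′ → q ≡ q′
odd-part-unique zero    zero     {q} {q′} _ _ eq = trans (sym (*-identityˡ q)) (trans eq (*-identityˡ q′))
odd-part-unique (suc e) (suc e′) {q} {q′} odd odd′ eq = odd-part-unique e e′ odd odd′
  (*-cancelˡ-≡ _ _ 2 (trans (sym (*-assoc 2 (2 ^ e) q)) (trans eq (*-assoc 2 (2 ^ e′) q′))))
odd-part-unique zero    (suc e′) {q} {q′} odd _ eq = contradiction odd (even⇒¬odd (2 ^ e′ * q′ , q≡))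
  where
  q≡ : q ≡ 2 ^ e′ * q′ * 2
  q≡ = begin
    q                    ≡⟨ sym (*-identityˡ q) ⟩
    1 * q                ≡⟨ eq ⟩
    2 * 2 ^ e′ * q′      ≡⟨ *-assoc 2 (2 ^ e′) q′ ⟩
    2 * (2 ^ e′ * q′)    ≡⟨ *-comm 2 (2 ^ e′ * q′) ⟩
    2 ^ e′ * q′ * 2      ∎
    where open ≡-Reasoning
odd-part-unique (suc e) zero     odd odd′ eq = sym (odd-part-unique zero (suc e) odd′ odd (sym eq))

div-exact : ∀ {n d q} .{{_ : NonZero d}} → n ≡ d * q → n div d ≡ q
div-exact {d = d} {q} refl = trans (cong (_div d) (*-comm d q)) (m*n/n≡m q d)

syracuse-spec : ∀ x → Odd (syracuse x) × 3 * x + 1 ≡ 2 ^ v2 (3 * x + 1) * syracuse x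
syracuse-spec x with v2-spec (3 * x + 1) (m≤n+m 1 (3 * x))
... | q , odd , eq = subst (λ s → Odd s × 3 * x + 1 ≡ 2 ^ v2 (3 * x + 1) * s) (sym S≡q) (odd , eq)
  where
  S≡q : syracuse x ≡ q
  S≡q = div-exact {{m^n≢0 2 (v2 (3 * x + 1))}} eq

syracuse-odd : ∀ x → Odd (syracuse x)
syracuse-odd x = proj₁ (syracuse-spec x)

syracuse-≡ : ∀ x {q} e → Odd q → 3 * x + 1 ≡ 2 ^ e * q → syracuse x ≡ q
syracuse-≡ x e odd eq = odd-part-unique (v2 (3 * x + 1)) e (syracuse-odd x) odd (trans (sym (proj₂ (syracuse-spec x))) eq)

syracuse-≤ : ∀ x {c} e → 3 * x + 1 ≡ 2 ^ e * c → syracuse x ≤ c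
syracuse-≤ x {zero}  e eq = contradiction (trans eq (*-zeroʳ (2 ^ e))) (>⇒≢ (m≤n+m 1 (3 * x)))
syracuse-≤ x {suc c} e eq with v2-spec (suc c) (s≤s z≤n)
... | q , odd , c≡2^j*q = subst (_≤ suc c) (sym (syracuse-≡ x (e + j) odd eq′)) q≤c
  where
  j = v2 (suc c)
  eq′ : 3 * x + 1 ≡ 2 ^ (e + j) * q
  eq′ = begin
    3 * x + 1             ≡⟨ eq ⟩
    2 ^ e * suc c         ≡⟨ cong (2 ^ e *_) c≡2^j*q ⟩
    2 ^ e * (2 ^ j * q)   ≡⟨ sym (*-assoc (2 ^ e) (2 ^ j) q) ⟩
    2 ^ e * 2 ^ j * q     ≡⟨ cong (_* q) (sym (^-distribˡ-+-* 2 e j)) ⟩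
    2 ^ (e + j) * q       ∎
    where open ≡-Reasoning
  q≤c : q ≤ suc c
  q≤c = subst (q ≤_) (sym c≡2^j*q) (m≤n*m q (2 ^ j) {{m^n≢0 2 j}})

syracuse-halves : ∀ x → Odd x → 2 * syracuse x ≤ 3 * x + 1
syracuse-halves x odd with odd⇒1mod2 {x} odd
... | a , refl = begin
  2 * syracuse (1 + a * 2)  ≤⟨ *-monoʳ-≤ 2 {y = 2 + a * 3} (syracuse-≤ (1 + a * 2) 1 (halve a)) ⟩
  2 * (2 + a * 3)           ≡⟨ halve a ⟨
  3 * (1 + a * 2) + 1       ∎
  where
  open ≤-Reasoning
  halve : ∀ a → 3 * (1 + a * 2) + 1 ≡ 2 * (2 + a * 3)
  halve = solve-∀

3x+1-affine : ∀ r K c L e t → 3 * r + 1 ≡ 2 ^ e * c → 3 * K ≡ 2 ^ e * L →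
              3 * (r + t * K) + 1 ≡ 2 ^ e * (c + t * L)
3x+1-affine r K c L e t r≡ K≡ = begin
  3 * (r + t * K) + 1           ≡⟨ expand r K t ⟩
  (3 * r + 1) + t * (3 * K)     ≡⟨ cong₂ (λ u v → u + t * v) r≡ K≡ ⟩
  2 ^ e * c + t * (2 ^ e * L)   ≡⟨ collect (2 ^ e) c L t ⟩
  2 ^ e * (c + t * L)           ∎
  where
  open ≡-Reasoning
  expand : ∀ r K t → 3 * (r + t * K) + 1 ≡ (3 * r + 1) + t * (3 * K)
  expand = solve-∀
  collect : ∀ p c L t → p * c + t * (p * L) ≡ p * (c + t * L)
  collect = solve-∀

syracuse-affine : ∀ r K q L e t → 3 * r + 1 ≡ 2 ^ e * q → 3 * K ≡ 2 ^ e * L → Odd q → L % 2 ≡ 0 →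
                  syracuse (r + t * K) ≡ q + t * L
syracuse-affine r K q L e t r≡ K≡ odd even =
  syracuse-≡ (r + t * K) e (odd+even {q} {t * L} odd (even-*ʳ t even)) (3x+1-affine r K q L e t r≡ K≡)

syracuse-affine-≤ : ∀ r K c L e t → 3 * r + 1 ≡ 2 ^ e * c → 3 * K ≡ 2 ^ e * L →
                    syracuse (r + t * K) ≤ c + t * L
syracuse-affine-≤ r K c L e t r≡ K≡ = syracuse-≤ (r + t * K) e (3x+1-affine r K c L e t r≡ K≡)

-- Orbits on residue classes

Orbit213 : ℕ → Set
Orbit213 m = syracuse m < m × m < syracuse (syracuse m)

orbit4 : ∀ {a b c d} → syracuse a ≡ b → syracuse b ≡ c → syracuse c ≡ d → orbit 4 a ≡ a ∷ b ∷ c ∷ d ∷ []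
orbit4 refl refl refl = refl

3mod4-ascends : ∀ {m} → m ≡ 3 ⟨mod 4 ⟩ → m < syracuse m
3mod4-ascends (t , refl) =
  subst (3 + t * 4 <_) (sym (syracuse-affine 3 4 5 6 1 t refl refl refl refl)) (affine-< 3 4 5 6 t)

5mod8-descends² : ∀ {m} → m ≡ 5 ⟨mod 8 ⟩ → syracuse (syracuse m) < m
5mod8-descends² (t , refl) = *-cancelˡ-< 2 _ _ (begin-strict
  2 * syracuse (syracuse m)   ≤⟨ syracuse-halves (syracuse m) (syracuse-odd m) ⟩
  3 * syracuse m + 1          ≤⟨ +-monoˡ-≤ 1 (*-monoʳ-≤ 3 (syracuse-affine-≤ 5 8 2 3 3 t refl refl)) ⟩
  3 * (2 + t * 3) + 1         ≡⟨ expand t ⟩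
  7 + t * 9                   <⟨ affine-< 7 9 10 16 t ⟩
  10 + t * 16                 ≡⟨ double t ⟩
  2 * m                       ∎)
  where
  open ≤-Reasoning
  m = 5 + t * 8
  expand : ∀ t → 3 * (2 + t * 3) + 1 ≡ 7 + t * 9
  expand = solve-∀
  double : ∀ t → 10 + t * 16 ≡ 2 * (5 + t * 8)
  double = solve-∀

1mod16-descends² : ∀ {m} → m ≡ 1 ⟨mod 16 ⟩ → syracuse (syracuse m) ≤ m
1mod16-descends² (t , refl) = begin
  syracuse (syracuse (1 + t * 16))  ≡⟨ cong syracuse (syracuse-affine 1 16 1 12 2 t refl refl refl refl) ⟩
  syracuse (1 + t * 12)             ≤⟨ syracuse-affine-≤ 1 12 1 9 2 t refl refl ⟩
  1 + t * 9                         ≤⟨ affine-≤ 1 9 1 16 t ⟩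
  1 + t * 16                        ∎
  where open ≤-Reasoning

orbit-9mod32 : ∀ t → orbit 4 (9 + t * 32) ≡ 9 + t * 32 ∷ 7 + t * 24 ∷ 11 + t * 36 ∷ 17 + t * 54 ∷ []
orbit-9mod32 t = orbit4 (syracuse-affine 9 32 7 24 2 t refl refl refl refl)
                        (syracuse-affine 7 24 11 36 1 t refl refl refl refl)
                        (syracuse-affine 11 36 17 54 1 t refl refl refl refl)

orbit-57mod64 : ∀ t → orbit 4 (57 + t * 64) ≡ 57 + t * 64 ∷ 43 + t * 48 ∷ 65 + t * 72 ∷ 49 + t * 54 ∷ []
orbit-57mod64 t = orbit4 (syracuse-affine 57 64 43 48 2 t refl refl refl refl)
                         (syracuse-affine 43 48 65 72 1 t refl refl refl refl)
                         (syracuse-affine 65 72 49 54 2 t refl refl refl refl)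

orbit-25mod64 : ∀ t → orbit 4 (25 + t * 64) ≡ 25 + t * 64 ∷ 19 + t * 48 ∷ 29 + t * 72 ∷ syracuse (29 + t * 72) ∷ []
orbit-25mod64 t = orbit4 (syracuse-affine 25 64 19 48 2 t refl refl refl refl)
                         (syracuse-affine 19 48 29 72 1 t refl refl refl refl)
                         refl

classify213 : ∀ m → Odd m → Orbit213 m → m ≡ 9 ⟨mod 32 ⟩ ⊎ m ≡ 57 ⟨mod 64 ⟩ ⊎ m ≡ 25 ⟨mod 64 ⟩
classify213 m odd (S<m , m<S²) with refine (odd⇒1mod2 {m} odd)
... | inj₂ m≡3[4] = contradiction (3mod4-ascends m≡3[4]) (<-asym S<m)
... | inj₁ m≡1[4] with refine m≡1[4]
...   | inj₂ m≡5[8] = contradiction (5mod8-descends² m≡5[8]) (<-asym m<S²)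
...   | inj₁ m≡1[8] with refine m≡1[8]
...     | inj₁ m≡1[16] = contradiction (1mod16-descends² m≡1[16]) (<⇒≱ m<S²)
...     | inj₂ m≡9[16] with refine m≡9[16]
...       | inj₁ m≡9[32] = inj₁ m≡9[32]
...       | inj₂ m≡25[32] with refine m≡25[32]
...         | inj₁ m≡25[64] = inj₂ (inj₂ m≡25[64])
...         | inj₂ m≡57[64] = inj₂ (inj₁ m≡57[64])

pattern-unique : ∀ {σ τ m} → length σ ≡ length τ → HasPattern σ m → HasPattern τ m → σ ≡ τ
pattern-unique {m = m} eq (_ , σ≡) (_ , τ≡) = trans (sym σ≡) (trans (cong (λ n → pattern′ (orbit n m)) eq) τ≡)

pattern⇒213 : ∀ {m i j k l} → pattern′ (orbit 4 m) ≡ i ∷ j ∷ k ∷ l ∷ [] → {T (j <ᵇ i)} → {T (i <ᵇ k)} → Orbit213 m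
pattern⇒213 {m} refl {j<i} {i<k} =
  rank-reflects-< (orbit 4 m) (<ᵇ⇒< _ _ j<i) , rank-reflects-< (orbit 4 m) (<ᵇ⇒< _ _ i<k)

hasPattern-9mod32 : ∀ {m} → m ≡ 9 ⟨mod 32 ⟩ → HasPattern σ2134 m
hasPattern-9mod32 (t , refl) = subst (λ xs → Pattern xs σ2134) (sym (orbit-9mod32 t))
  (pattern⇒Pattern (pattern-2134 (affine-< 7 24 9 32 t) (affine-< 9 32 11 36 t) (affine-< 11 36 17 54 t)))

hasPattern-57mod64 : ∀ {m} → m ≡ 57 ⟨mod 64 ⟩ → HasPattern σ3142 m
hasPattern-57mod64 (t , refl) = subst (λ xs → Pattern xs σ3142) (sym (orbit-57mod64 t))
  (pattern⇒Pattern (pattern-3142 (affine-< 43 48 49 54 t) (affine-< 49 54 57 64 t) (affine-< 57 64 65 72 t)))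

hasPattern-25mod64 : ∀ {m} → m ≡ 25 ⟨mod 64 ⟩ → HasPattern σ3241 m
hasPattern-25mod64 (t , refl) = subst (λ xs → Pattern xs σ3241) (sym (orbit-25mod64 t))
  (pattern⇒Pattern (pattern-3241 S³<S (affine-< 19 48 25 64 t) (affine-< 25 64 29 72 t)))
  where
  S³<S : syracuse (29 + t * 72) < 19 + t * 48
  S³<S = ≤-<-trans (syracuse-affine-≤ 29 72 11 27 3 t refl refl) (affine-< 11 27 19 48 t)

patterns-of-213 : ∀ m → Odd m → Orbit213 m →
  HasPattern σ2134 m ⊎ HasPattern σ2143 m ⊎ HasPattern σ3142 m ⊎ HasPattern σ3241 m
patterns-of-213 m odd o =
  [ inj₁ ∘′ hasPattern-9mod32 , [ inj₂ ∘′ inj₂ ∘′ inj₁ ∘′ hasPattern-57mod64 , inj₂ ∘′ inj₂ ∘′ inj₂ ∘′ hasPattern-25mod64 ]′ ]′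
    (classify213 m odd o)

residueClass-of-pattern : ∀ m {σ} → length σ ≡ 4 → Odd m → Orbit213 m → HasPattern σ m →
  σ ≡ σ2134 × (m ≡ 9 ⟨mod 32 ⟩) ⊎ σ ≡ σ3142 × (m ≡ 57 ⟨mod 64 ⟩) ⊎ σ ≡ σ3241 × (m ≡ 25 ⟨mod 64 ⟩)
residueClass-of-pattern m len odd o p = case classify213 m odd o of λ where
  (inj₁ c)        → inj₁ (pattern-unique len p (hasPattern-9mod32 c) , c)
  (inj₂ (inj₁ c)) → inj₂ (inj₁ (pattern-unique len p (hasPattern-57mod64 c) , c))
  (inj₂ (inj₂ c)) → inj₂ (inj₂ (pattern-unique len p (hasPattern-25mod64 c) , c))

pattern2143-impossible : ∀ m → Odd m → ¬ HasPattern σ2143 m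
pattern2143-impossible m odd p = case residueClass-of-pattern m refl odd (pattern⇒213 (proj₂ p)) p of λ where
  (inj₁ (() , _))
  (inj₂ (inj₁ (() , _)))
  (inj₂ (inj₂ (() , _)))

pattern2134≐9mod32 : (λ m → Odd m × HasPattern σ2134 m) ≐ (λ m → m ≡ 9 ⟨mod 32 ⟩)
pattern2134≐9mod32 = forward , λ c → odd-progression 9 32 refl refl c , hasPattern-9mod32 c
  where
  forward : ∀ {m} → Odd m × HasPattern σ2134 m → m ≡ 9 ⟨mod 32 ⟩
  forward {m} (odd , p) = case residueClass-of-pattern m refl odd (pattern⇒213 (proj₂ p)) p of λ where
    (inj₁ (_ , c)) → c
    (inj₂ (inj₁ (() , _)))
    (inj₂ (inj₂ (() , _)))

pattern3142≐57mod64 : (λ m → Odd m × HasPattern σ3142 m) ≐ (λ m → m ≡ 57 ⟨mod 64 ⟩)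
pattern3142≐57mod64 = forward , λ c → odd-progression 57 64 refl refl c , hasPattern-57mod64 c
  where
  forward : ∀ {m} → Odd m × HasPattern σ3142 m → m ≡ 57 ⟨mod 64 ⟩
  forward {m} (odd , p) = case residueClass-of-pattern m refl odd (pattern⇒213 (proj₂ p)) p of λ where
    (inj₁ (() , _))
    (inj₂ (inj₁ (_ , c))) → c
    (inj₂ (inj₂ (() , _)))

pattern3241≐25mod64 : (λ m → Odd m × HasPattern σ3241 m) ≐ (λ m → m ≡ 25 ⟨mod 64 ⟩)
pattern3241≐25mod64 = forward , λ c → odd-progression 25 64 refl refl c , hasPattern-25mod64 c
  where
  forward : ∀ {m} → Odd m × HasPattern σ3241 m → m ≡ 25 ⟨mod 64 ⟩
  forward {m} (odd , p) = case residueClass-of-pattern m refl odd (pattern⇒213 (proj₂ p)) p of λ where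
    (inj₁ (() , _))
    (inj₂ (inj₁ (() , _)))
    (inj₂ (inj₂ (_ , c))) → c

hasDensity-of-residueClass : ∀ σ D′ r {_ : T (r <ᵇ 2 * suc D′)} →
  (λ m → Odd m × HasPattern σ m) ≐ (λ m → m ≡ r ⟨mod 2 * suc D′ ⟩) →
  Counting.count (λ m → m % (2 * suc D′) ≟ r) (2 * suc D′) ≡ 1 →
  HasDensity σ (+ 1 / suc D′)
hasDensity-of-residueClass σ D′ r {r<K} pattern≐class one =
  ratiosTendTo-1/D (λ k → 2 * Γ σ (suc k)) D′ (suc K) upper lower
  where
  K = 2 * suc D′
  open Counting (λ m → m % K ≟ r)
  periodic : (λ m → m % K ≡ r) ≐ (λ m → (m + K) % K ≡ r)
  periodic = (λ {n} → trans ([m+n]%n≡m%n n K)) , (λ {n} → trans (sym ([m+n]%n≡m%n n K)))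
  Γ≡count : ∀ k → Γ σ (suc k) ≡ count (suc (suc k))
  Γ≡count k = cong length (filter-≐ (λ m → odd? m ×-dec hasPattern? σ m) (λ m → m % K ≟ r)
                                    (≐-trans pattern≐class (⟨mod⟩≐% r K {r<K})) (upTo (suc (suc k))))
  rescale : ∀ c D′ → 2 * c * suc D′ ≡ c * (2 * suc D′)
  rescale = solve-∀
  scaled : ∀ k → 2 * Γ σ (suc k) * suc D′ ≡ count (suc (suc k)) * K
  scaled k = trans (cong (λ c → 2 * c * suc D′) (Γ≡count k)) (rescale (count (suc (suc k))) D′)
  upper : ∀ k → 2 * Γ σ (suc k) * suc D′ ≤ suc k + suc K
  upper k = subst₂ _≤_ (sym (scaled k)) (sym (+-suc (suc k) K)) (proj₁ (count-bounds K periodic one (suc (suc k))))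
  lower : ∀ k → suc k ≤ 2 * Γ σ (suc k) * suc D′ + suc K
  lower k = subst (λ x → suc k ≤ x + suc K) (sym (scaled k))
    (≤-trans (n≤1+n (suc k)) (≤-trans (proj₂ (count-bounds K periodic one (suc (suc k)))) (+-monoʳ-≤ _ (n≤1+n K))))

mainTheorem13 :
    ((m : ℕ) → Odd m → Unique (orbit 4 m) →
      syracuse m < m → m < syracuse (syracuse m) →
      HasPattern (2 ∷ 1 ∷ 3 ∷ 4 ∷ []) m ⊎ HasPattern (2 ∷ 1 ∷ 4 ∷ 3 ∷ []) m
        ⊎ HasPattern (3 ∷ 1 ∷ 4 ∷ 2 ∷ []) m ⊎ HasPattern (3 ∷ 2 ∷ 4 ∷ 1 ∷ []) m)
    × HasDensity (2 ∷ 1 ∷ 3 ∷ 4 ∷ []) (+ 1 / 16)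
    × HasDensity (3 ∷ 1 ∷ 4 ∷ 2 ∷ []) (+ 1 / 32)
    × HasDensity (3 ∷ 2 ∷ 4 ∷ 1 ∷ []) (+ 1 / 32)
    × HasDensity (2 ∷ 1 ∷ 4 ∷ 3 ∷ []) 0ℚ
    × ((m : ℕ) → Odd m → ¬ HasPattern (2 ∷ 1 ∷ 4 ∷ 3 ∷ []) m)
mainTheorem13 =
  (λ m odd _ S<m m<S² → patterns-of-213 m odd (S<m , m<S²)) ,
  hasDensity-of-residueClass σ2134 15 9 pattern2134≐9mod32 refl ,
  hasDensity-of-residueClass σ3142 31 57 pattern3142≐57mod64 refl ,
  hasDensity-of-residueClass σ3241 31 25 pattern3241≐25mod64 refl ,
  ratiosTendTo-0 (λ k → 2 * Γ σ2143 (suc k)) (λ k → cong (2 *_) (Γ2143≡0 k)) ,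
  pattern2143-impossible
  where
  Γ2143≡0 : ∀ k → Γ σ2143 (suc k) ≡ 0
  Γ2143≡0 k = cong length (filter-none (λ m → odd? m ×-dec hasPattern? σ2143 m) (universal (λ m (odd , p) → pattern2143-impossible m odd p) (upTo (suc (suc k)))))
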